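{- Let $\rho$ be a $2$-polymatroid and $e$ a line of $\rho$, with $X_e=\{e_1,e_2\}$. Then $M^2_{\rho_{\downarrow e}}=M^2_\rho/e_1\setminus e_2$. If, in addition, no line of $\rho$ is parallel to $e$, then $M_{\rho_{\downarrow e}}=M_\rho/e_1\setminus e_2$.
   Context: A (integer) polymatroid is $(E,\rho)$ with $E$ finite, $\rho:2^E\to\mathbb{Z}$ normalized, nondecreasing and submodular; a $2$-polymatroid has $\rho(\{e\})\le 2$ for all $e$; $e$ is a line if $\rho(\{e\})=2$. Elements $e,f$ are parallel if $0<\rho(e)=\rho(f)=\rho(\{e,f\})$. Natural matroid $M_\rho$: pairwise disjoint sets $X_e$ with $|X_e|=\rho(\{e\})$, $X_A=\bigcup_{e\in A}X_e$, rank $r(X)=\min\{\rho(A)+|X-X_A|:A\subseteq E\}$ on $X_E$. The $2$-natural matroid $M^2_\rho$ is obtained from $M_\rho$ by, for each $e$, freely adding (iterated principal extension to $X_e$) a set $U_e$ of $2-\rho(\{e\})$ new elements; $Y_e=X_e\cup U_e$ (for a line, $Y_e=X_e$). Compression: for $\rho(e)>0$, $\rho_{\downarrow e}$ is the polymatroid on $E-e$ with $\rho_{\downarrow e}(X)=\rho(X)-1$ if $\rho(X\cup e)=\rho(X)$ and $\rho_{\downarrow e}(X)=\rho(X)$ otherwise. -}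

module Defs where

open import Data.Bool using (Bool; true; false; if_then_else_; _∧_; _∨_; not)
open import Data.Nat using (ℕ; zero; suc; _+_; _∸_; _≤_; _<_; _<ᵇ_; _≡ᵇ_; _⊓_)
open import Data.Fin using (Fin; zero; suc; toℕ)
open import Data.Fin.Subset using (Subset; ⊥; ⁅_⁆; _∪_; _∩_; _─_; _⊆_; ∣_∣)
open import Data.Vec using (Vec; []; _∷_; tabulate; lookup; zipWith; insertAt; removeAt; replicate)
open import Data.List using (List; []; _∷_; _++_; map; foldr; foldl; filter; concatMap)
open import Data.Product using (_×_; _,_)
open import Relation.Binary.PropositionalEquality using (_≡_; _≢_)
open import Relation.Nullary using (¬_)
open import Data.Nat using (_≤?_)

-- Rank functions take values in ℕ (normalized + nondecreasing forces
-- nonnegativity, so this is the same as integer-valued).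

record IsPolymatroid {n : ℕ} (ρ : Subset n → ℕ) : Set where
  field
    normalized   : ρ ⊥ ≡ 0
    nondecreasing : ∀ A B → A ⊆ B → ρ A ≤ ρ B
    submodular   : ∀ A B → ρ (A ∪ B) + ρ (A ∩ B) ≤ ρ A + ρ B

record Is2Polymatroid {n : ℕ} (ρ : Subset n → ℕ) : Set where
  field
    isPolymatroid : IsPolymatroid ρ
    atMost2       : ∀ e → ρ ⁅ e ⁆ ≤ 2

IsLine : ∀ {n} → (Subset n → ℕ) → Fin n → Set
IsLine ρ e = ρ ⁅ e ⁆ ≡ 2

Parallel : ∀ {n} → (Subset n → ℕ) → Fin n → Fin n → Set
Parallel ρ e f = (0 < ρ ⁅ e ⁆) × (ρ ⁅ e ⁆ ≡ ρ ⁅ f ⁆) × (ρ ⁅ f ⁆ ≡ ρ (⁅ e ⁆ ∪ ⁅ f ⁆))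

NoLineParallelTo : ∀ {n} → (Subset n → ℕ) → Fin n → Set
NoLineParallelTo ρ e = ∀ f → f ≢ e → IsLine ρ f → ¬ Parallel ρ e f

-- Compression.  E - e, for e : Fin (suc n), is identified with Fin n
-- via Data.Fin.punchIn e (i.e. a subset X of Fin n corresponds to the
-- subset  insertAt X e false  of Fin (suc n)).

liftSub : ∀ {n} → Fin (suc n) → Subset n → Subset (suc n)
liftSub e X = insertAt X e false

compress : ∀ {n} → (Subset (suc n) → ℕ) → Fin (suc n) → Subset n → ℕ
compress ρ e X =
  if ρ (liftSub e X ∪ ⁅ e ⁆) ≡ᵇ ρ (liftSub e X)
  then ρ (liftSub e X) ∸ 1
  else ρ (liftSub e X)

-- For a 2-polymatroid every Y_e has exactly two elements; we encode
-- Y_e as Fin 2 (slots), with X_e = the slots i with toℕ i < ρ({e})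
-- and U_e = the remaining slots.  So the ground set of M²_ρ is
-- E × Fin 2, and a subset of it is a GSub n = Vec (Subset 2) n.

GSub : ℕ → Set
GSub n = Vec (Subset 2) n

_∪ᵍ_ : ∀ {n} → GSub n → GSub n → GSub n
_∪ᵍ_ = zipWith _∪_

_∩ᵍ_ : ∀ {n} → GSub n → GSub n → GSub n
_∩ᵍ_ = zipWith _∩_

_─ᵍ_ : ∀ {n} → GSub n → GSub n → GSub n
_─ᵍ_ = zipWith _─_

_⊆ᵍ_ : ∀ {n} → GSub n → GSub n → Set
X ⊆ᵍ Y = ∀ f → lookup X f ⊆ lookup Y f

∣_∣ᵍ : ∀ {n} → GSub n → ℕ
∣ [] ∣ᵍ = 0
∣ S ∷ X ∣ᵍ = ∣ S ∣ + ∣ X ∣ᵍ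

emptyᵍ : ∀ {n} → GSub n
emptyᵍ = replicate _ ⊥

elemᵍ : ∀ {n} → Fin n → Fin 2 → GSub n
elemᵍ e i = tabulate λ f → if Data.Fin._≟_ f e .Relation.Nullary.Dec.does then ⁅ i ⁆ else ⊥
  where import Data.Fin

below : ℕ → Subset 2
below k = tabulate λ i → toℕ i <ᵇ k

Xof : ∀ {n} → (Subset n → ℕ) → Fin n → GSub n
Xof ρ e = tabulate λ f → if Data.Fin._≟_ f e .Relation.Nullary.Dec.does then below (ρ ⁅ e ⁆) else ⊥
  where import Data.Fin

XA : ∀ {n} → (Subset n → ℕ) → Subset n → GSub n
XA ρ A = tabulate λ f → if lookup A f then below (ρ ⁅ f ⁆) else ⊥

XE : ∀ {n} → (Subset n → ℕ) → GSub n
XE ρ = tabulate λ f → below (ρ ⁅ f ⁆)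

-- The natural matroid M_ρ, via its rank function
--   r(X) = min { ρ(A) + |X - X_A| : A ⊆ E }     (for X ⊆ X_E)

allSubsets : ∀ n → List (Subset n)
allSubsets zero    = [] ∷ []
allSubsets (suc n) = concatMap (λ A → (false ∷ A) ∷ (true ∷ A) ∷ []) (allSubsets n)

natRank : ∀ {n} → (Subset n → ℕ) → GSub n → ℕ
natRank {n} ρ X = foldr (λ A m → val A ⊓ m) (val ⊥) (allSubsets n)
  where
  val : Subset n → ℕ
  val A = ρ A + ∣ X ─ᵍ XA ρ A ∣ᵍ

-- Principal extension of a matroid (given by a rank function r on
-- subsets of E × Fin 2, which ignores elements not yet in its ground
-- set) by a new element p = (f , i) placed freely on the set F:
--   r'(S) = r(S)               if p ∉ S
--   r'(S) = r(S - p)           if p ∈ S and r((S - p) ∪ F) = r(S - p)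
--   r'(S) = r(S - p) + 1       otherwise.

principalExt : ∀ {n} → (GSub n → ℕ) → Fin n → Fin 2 → GSub n → (GSub n → ℕ)
principalExt r f i F S =
  if lookup (lookup S f) i
  then (if r (S' ∪ᵍ F) ≡ᵇ r S' then r S' else suc (r S'))
  else r S
  where
  S' = S ─ᵍ elemᵍ f i

allPairs : ∀ n → List (Fin n × Fin 2)
allPairs n = concatMap (λ f → (f , zero) ∷ (f , suc zero) ∷ []) (Data.List.allFin n)
  where import Data.List

-- the new elements ⋃_e U_e, in a fixed order
newElems : ∀ {n} → (Subset n → ℕ) → List (Fin n × Fin 2)
newElems {n} ρ = filter (λ p → ρ ⁅ proj₁ p ⁆ ≤? toℕ (proj₂ p)) (allPairs n)
  where open Data.Product using (proj₁; proj₂)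

-- base: M_ρ, seen on E × Fin 2 (elements outside X_E ignored)
-- then each u ∈ U_f is added by principal extension onto X_f.
rank2 : ∀ {n} → (Subset n → ℕ) → GSub n → ℕ
rank2 ρ = foldl (λ r p → principalExt r (proj₁ p) (proj₂ p) (Xof ρ (proj₁ p)))
                (λ S → natRank ρ (S ∩ᵍ XE ρ))
                (newElems ρ)
  where open Data.Product using (proj₁; proj₂)

-- For a matroid with rank function r on (a subset of)
-- Fin (suc n) × Fin 2, e : Fin (suc n) and i : Fin 2, the rank function of
--   M / (e , i) \ (the other element(s) of Y_e)
-- on subsets of (E - e) × Fin 2 ≅ Fin n × Fin 2 (via punchIn e):
--   X ↦ r(X ∪ {(e,i)}) - r({(e,i)}).

contractDelete : ∀ {n} → (GSub (suc n) → ℕ) → Fin (suc n) → Fin 2 → GSub n → ℕ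
contractDelete r e i X = r (insertAt X e ⁅ i ⁆) ∸ r (elemᵍ e i)

-- ground set of M_ρ / (e,i) \ (e,j)  (as a subset of (E - e) × Fin 2)
groundMinor : ∀ {n} → (Subset (suc n) → ℕ) → Fin (suc n) → GSub n
groundMinor ρ e = removeAt (XE ρ) e

-- For z assigning to each element f a set z(f) ⊆ {0,1} of slots, let
--   r_z(W) = min_A ρ(A) + |W − Z_A|,   Z_A = ⋃_{f ∈ A} {f} × z(f).
-- M_ρ has rank r_z for z(f) = X_f.  For z(f) = {0,1} the value at a set whose slots at f are t is
-- min(|t| + a, b) with b ≤ ρ(f) + a, which is exactly how the rank changes when a point is added
-- freely to X_f; so this r_z is the rank of M²_ρ.
-- Splitting A according to whether it contains e, for i ∈ z(e),
--   r_z(W + (e,i)) = min_B min(1 + ρ(B), ρ(B ∪ e)) + |W − Z_B|,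
-- and min(1 + ρ(B), ρ(B ∪ e)) = 1 + ρ_{↓e}(B) because e is not a loop.  Hence contracting (e,i) and
-- deleting the rest of Y_e turns r_z for ρ into r_z for ρ_{↓e}.  With no line parallel to e,
-- compression keeps every ρ({f}), hence every X_f, which gives the statement for M_ρ.

module Submission where

open import Defs
open import Data.Bool using (Bool; true; false; if_then_else_; _∨_; _∧_)
open import Data.Bool.Properties using (∨-identityʳ; ∨-zeroʳ; T-≡)
open import Data.Nat using (ℕ; zero; suc; _+_; _∸_; _≤_; _<_; _⊓_; _≡ᵇ_; _<ᵇ_; _≤?_; _<?_; z≤n; s≤s)
open import Data.Nat.Properties renaming (_≟_ to _≟ℕ_)
open import Data.Fin using (Fin; zero; suc; toℕ; punchIn; _≟_)
open import Data.Fin.Properties using (punchInᵢ≢i; toℕ<n)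
open import Data.Fin.Subset using (Subset; ⊥; ⊤; ⁅_⁆; _∪_; _∩_; _─_; _⊆_; _∈_; ∣_∣)
open import Data.Fin.Subset.Properties
  using (∈⊤; ⊥⊆; ⊆⊤; ⊆-antisym; drop-∷-⊆; x∈⁅x⁆; x∈⁅y⁆⇒x≡y; x∈p∩q⁺; p∩q⊆q; p⊆p∪q; q⊆p∪q;
         ∪-identityˡ; ∪-identityʳ; ∩-identityʳ; p─⊥≡p; p─⊤≡⊥; ∣⊥∣≡0; ∣⁅x⁆∣≡1; p⊆q⇒∣p∣≤∣q∣)
open import Data.Vec using (Vec; []; _∷_; here; tabulate; lookup; zipWith; insertAt; removeAt; replicate)
open import Data.Vec.Properties
  using (tabulate∘lookup; tabulate-cong; lookup∘tabulate; lookup-zipWith; zipWith-identityʳ;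
         insertAt-lookup; insertAt-removeAt; lookup⇒[]=)
open import Data.List using ([]; _∷_; foldr; foldl)
open import Data.List.Relation.Unary.Any as Any using ()
open import Data.List.Membership.Propositional using () renaming (_∈_ to _∈ˡ_)
open import Data.List.Membership.Propositional.Properties using (∈-concatMap⁺; ∈-filter⁺; ∈-allFin)
open import Data.Product using (_×_; _,_; ∃; proj₁; proj₂)
open import Data.Sum using (inj₁; inj₂)
open import Function using (_∘_)
open import Function.Bundles using (Equivalence)
open import Relation.Binary.PropositionalEquality
open import Relation.Nullary using (does; yes; no; contradiction)
open import Relation.Nullary.Decidable using (dec-true; dec-false)

lookup-extensionality : ∀ {A : Set} {n} {xs ys : Vec A n} →
  (∀ i → lookup xs i ≡ lookup ys i) → xs ≡ ys
lookup-extensionality {xs = xs} {ys} eq =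
  trans (sym (tabulate∘lookup xs)) (trans (tabulate-cong eq) (tabulate∘lookup ys))

tabulate-const : ∀ {A : Set} n (y : A) → tabulate {n = n} (λ _ → y) ≡ replicate n y
tabulate-const zero    y = refl
tabulate-const (suc n) y = cong (y ∷_) (tabulate-const n y)

tabulate-≟ : ∀ {A : Set} {n} (i : Fin (suc n)) (x y : A) →
  tabulate (λ j → if does (j ≟ i) then x else y) ≡ insertAt (replicate n y) i x
tabulate-≟ {n = n}     zero    x y = cong (x ∷_) (tabulate-const n y)
tabulate-≟ {n = suc n} (suc i) x y = cong (y ∷_) (tabulate-≟ i x y)

removeAt-tabulate : ∀ {A : Set} {n} (h : Fin (suc n) → A) e →
  removeAt (tabulate h) e ≡ tabulate (h ∘ punchIn e)
removeAt-tabulate             h zero    = refl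
removeAt-tabulate {n = suc n} h (suc e) = cong (h zero ∷_) (removeAt-tabulate (h ∘ suc) e)

zipWith-insertAt : ∀ {A B C : Set} {n} (_•_ : A → B → C) (xs : Vec A n) (ys : Vec B n)
  (i : Fin (suc n)) x y →
  zipWith _•_ (insertAt xs i x) (insertAt ys i y) ≡ insertAt (zipWith _•_ xs ys) i (x • y)
zipWith-insertAt _•_ xs        ys        zero    x y = refl
zipWith-insertAt _•_ (x′ ∷ xs) (y′ ∷ ys) (suc i) x y =
  cong (x′ • y′ ∷_) (zipWith-insertAt _•_ xs ys i x y)

─-⊆ : ∀ {n} {p q : Subset n} → p ⊆ q → p ─ q ≡ ⊥
─-⊆ {p = []}        {[]}        _   = refl
─-⊆ {p = _ ∷ _}     {true ∷ _}  p⊆q = cong (false ∷_) (─-⊆ (drop-∷-⊆ p⊆q))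
─-⊆ {p = false ∷ _} {false ∷ _} p⊆q = cong (false ∷_) (─-⊆ (drop-∷-⊆ p⊆q))
─-⊆ {p = true ∷ _}  {false ∷ _} p⊆q with () ← p⊆q here

insertAt-⊥ : ∀ {n} (e : Fin (suc n)) → insertAt ⊥ e false ≡ ⊥
insertAt-⊥         zero    = refl
insertAt-⊥ {suc n} (suc e) = cong (false ∷_) (insertAt-⊥ e)

insertAt-⊥-true : ∀ {n} (e : Fin (suc n)) → insertAt ⊥ e true ≡ ⁅ e ⁆
insertAt-⊥-true         zero    = refl
insertAt-⊥-true {suc n} (suc e) = cong (false ∷_) (insertAt-⊥-true e)

insertAt-⁅⁆ : ∀ {n} (e : Fin (suc n)) (f : Fin n) → insertAt ⁅ f ⁆ e false ≡ ⁅ punchIn e f ⁆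
insertAt-⁅⁆ zero    f       = refl
insertAt-⁅⁆ (suc e) zero    = cong (true ∷_) (insertAt-⊥ e)
insertAt-⁅⁆ (suc e) (suc f) = cong (false ∷_) (insertAt-⁅⁆ e f)

insertAt-∪-⁅⁆ : ∀ {n} (B : Subset n) (e : Fin (suc n)) → insertAt B e false ∪ ⁅ e ⁆ ≡ insertAt B e true
insertAt-∪-⁅⁆ B e = begin
  insertAt B e false ∪ ⁅ e ⁆         ≡⟨ cong (insertAt B e false ∪_) (insertAt-⊥-true e) ⟨
  insertAt B e false ∪ insertAt ⊥ e true ≡⟨ zipWith-insertAt _∨_ B ⊥ e false true ⟩
  insertAt (B ∪ ⊥) e true            ≡⟨ cong (λ C → insertAt C e true) (∪-identityʳ B) ⟩
  insertAt B e true                  ∎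
  where open ≡-Reasoning

insertAt-⁅⁆-true : ∀ {n} (e : Fin (suc n)) (f : Fin n) → insertAt ⁅ f ⁆ e true ≡ ⁅ e ⁆ ∪ ⁅ punchIn e f ⁆
insertAt-⁅⁆-true e f = begin
  insertAt ⁅ f ⁆ e true                    ≡⟨ cong (λ A → insertAt A e true) (∪-identityˡ ⁅ f ⁆) ⟨
  insertAt (⊥ ∪ ⁅ f ⁆) e true              ≡⟨ zipWith-insertAt _∨_ ⊥ ⁅ f ⁆ e true false ⟨
  insertAt ⊥ e true ∪ insertAt ⁅ f ⁆ e false ≡⟨ cong₂ _∪_ (insertAt-⊥-true e) (insertAt-⁅⁆ e f) ⟩
  ⁅ e ⁆ ∪ ⁅ punchIn e f ⁆                  ∎
  where open ≡-Reasoning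

∈-below : ∀ {k} {j : Fin 2} → toℕ j < k → j ∈ below k
∈-below {k} {j} j<k =
  lookup⇒[]= j (below k) (trans (lookup∘tabulate (λ i → toℕ i <ᵇ k) j) (Equivalence.to T-≡ (<⇒<ᵇ j<k)))

k≤∣below∣ : ∀ k → k ≤ 2 → k ≤ ∣ below k ∣
k≤∣below∣ 0 _ = z≤n
k≤∣below∣ 1 _ = ≤-refl
k≤∣below∣ 2 _ = ≤-refl
k≤∣below∣ (suc (suc (suc _))) (s≤s (s≤s ()))

─-if-⊆ : ∀ {w x : Subset 2} → w ⊆ x → ∀ b → w ─ (if b then x else ⊥) ≡ w ─ (if b then ⊤ else ⊥)
─-if-⊆ {w} w⊆x true  = trans (─-⊆ w⊆x) (sym (p─⊤≡⊥ w))
─-if-⊆     w⊆x false = refl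

∩-∪-⁅⁆-∉ : ∀ (s g : Subset 2) i → lookup s i ≡ false → s ∩ (g ∪ ⁅ i ⁆) ≡ s ∩ g
∩-∪-⁅⁆-∉ (false ∷ b ∷ []) (c ∷ d ∷ []) zero       refl = cong (λ x → false ∷ b ∧ x ∷ []) (∨-identityʳ d)
∩-∪-⁅⁆-∉ (a ∷ false ∷ []) (c ∷ d ∷ []) (suc zero) refl = cong (λ x → a ∧ x ∷ false ∷ []) (∨-identityʳ c)

∣∩-∪-⁅⁆∣-∈ : ∀ (s g : Subset 2) i → lookup s i ≡ true → ∣ s ∩ (g ∪ ⁅ i ⁆) ∣ ≡ suc ∣ (s ─ ⁅ i ⁆) ∩ g ∣
∣∩-∪-⁅⁆∣-∈ (true ∷ b ∷ []) (c ∷ d ∷ []) zero refl rewrite ∨-zeroʳ c | ∨-identityʳ d = refl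
∣∩-∪-⁅⁆∣-∈ (a ∷ true ∷ []) (c ∷ d ∷ []) (suc zero) refl rewrite ∨-identityʳ c | ∨-zeroʳ d with a ∧ c
... | true  = refl
... | false = refl

∣insertAt∣ᵍ : ∀ {n} (X : GSub n) (i : Fin (suc n)) s → ∣ insertAt X i s ∣ᵍ ≡ ∣ X ∣ᵍ + ∣ s ∣
∣insertAt∣ᵍ X       zero    s = +-comm ∣ s ∣ ∣ X ∣ᵍ
∣insertAt∣ᵍ (x ∷ X) (suc i) s =
  trans (cong (∣ x ∣ +_) (∣insertAt∣ᵍ X i s)) (sym (+-assoc (∣ x ∣) (∣ X ∣ᵍ) (∣ s ∣)))

∣emptyᵍ─ᵍ∣ : ∀ {n} (W : GSub n) → ∣ emptyᵍ ─ᵍ W ∣ᵍ ≡ 0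
∣emptyᵍ─ᵍ∣ []      = refl
∣emptyᵍ─ᵍ∣ (w ∷ W) = cong₂ _+_ (trans (cong ∣_∣ (─-⊆ {q = w} ⊥⊆)) (∣⊥∣≡0 2)) (∣emptyᵍ─ᵍ∣ W)

elemᵍ-insertAt : ∀ {n} (f : Fin (suc n)) i → elemᵍ f i ≡ insertAt emptyᵍ f ⁅ i ⁆
elemᵍ-insertAt f i = tabulate-≟ f ⁅ i ⁆ ⊥

Xof-insertAt : ∀ {n} (ρ : Subset (suc n) → ℕ) f → Xof ρ f ≡ insertAt emptyᵍ f (below (ρ ⁅ f ⁆))
Xof-insertAt ρ f = tabulate-≟ f (below (ρ ⁅ f ⁆)) ⊥

∪ᵍ-slot : ∀ {n} (X : GSub n) f t u → insertAt X f t ∪ᵍ insertAt emptyᵍ f u ≡ insertAt X f (t ∪ u)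
∪ᵍ-slot X f t u = trans (zipWith-insertAt _∪_ X emptyᵍ f t u)
                        (cong (λ Y → insertAt Y f (t ∪ u)) (zipWith-identityʳ ∪-identityʳ X))

─ᵍ-slot : ∀ {n} (X : GSub n) f t u → insertAt X f t ─ᵍ insertAt emptyᵍ f u ≡ insertAt X f (t ─ u)
─ᵍ-slot X f t u = trans (zipWith-insertAt _─_ X emptyᵍ f t u)
                        (cong (λ Y → insertAt Y f (t ─ u)) (zipWith-identityʳ p─⊥≡p X))

⊆ᵍ-∪ᵍ : ∀ {n} (G H : GSub n) → G ⊆ᵍ (G ∪ᵍ H)
⊆ᵍ-∪ᵍ G H f = subst (lookup G f ⊆_) (sym (lookup-zipWith _∪_ f G H)) (p⊆p∪q _)

lookup-elemᵍ : ∀ {n} (f : Fin n) i → lookup (elemᵍ f i) f ≡ ⁅ i ⁆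
lookup-elemᵍ f i = trans (lookup∘tabulate _ f) (cong (if_then ⁅ i ⁆ else ⊥) (dec-true (f ≟ f) refl))

∩ᵍ-full : ∀ {n} (S G : GSub n) → (∀ f j → j ∈ lookup G f) → S ∩ᵍ G ≡ S
∩ᵍ-full S G full = lookup-extensionality {xs = S ∩ᵍ G} {ys = S} λ f →
  trans (lookup-zipWith _∩_ f S G) (trans (cong (lookup S f ∩_) (⊆-antisym ⊆⊤ λ {j} _ → full f j))
                                          (∩-identityʳ _))

allPairs-complete : ∀ {n} (f : Fin n) j → (f , j) ∈ˡ allPairs n
allPairs-complete f j = ∈-concatMap⁺ _ (Any.map (λ { refl → pair∈ j }) (∈-allFin f))
  where
  pair∈ : ∀ j → (f , j) ∈ˡ (f , zero) ∷ (f , suc zero) ∷ []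
  pair∈ zero       = Any.here refl
  pair∈ (suc zero) = Any.there (Any.here refl)

-- Minimum over all subsets

minOver : ∀ {n} → (Subset n → ℕ) → ℕ
minOver {n} g = foldr (λ A m → g A ⊓ m) (g ⊥) (allSubsets n)

allSubsets-complete : ∀ {n} (A : Subset n) → A ∈ˡ allSubsets n
allSubsets-complete []          = Any.here refl
allSubsets-complete (false ∷ A) =
  ∈-concatMap⁺ _ (Any.map (λ { refl → Any.here refl }) (allSubsets-complete A))
allSubsets-complete (true ∷ A)  =
  ∈-concatMap⁺ _ (Any.map (λ { refl → Any.there (Any.here refl) }) (allSubsets-complete A))

minOver-≤ : ∀ {n} (g : Subset n → ℕ) A → minOver g ≤ g A
minOver-≤ {n} g A = go (allSubsets n) (allSubsets-complete A)
  where
  go : ∀ xs → A ∈ˡ xs → foldr (λ A m → g A ⊓ m) (g ⊥) xs ≤ g A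
  go (_ ∷ xs) (Any.here refl) = m⊓n≤m (g A) _
  go (x ∷ xs) (Any.there A∈xs) = ≤-trans (m⊓n≤n (g x) _) (go xs A∈xs)

minOver-attained : ∀ {n} (g : Subset n → ℕ) → ∃ λ A → minOver g ≡ g A
minOver-attained {n} g = go (allSubsets n)
  where
  go : ∀ xs → ∃ λ A → foldr (λ A m → g A ⊓ m) (g ⊥) xs ≡ g A
  go []       = ⊥ , refl
  go (x ∷ xs) with ⊓-sel (g x) (foldr (λ A m → g A ⊓ m) (g ⊥) xs)
  ... | inj₁ eq = x , eq
  ... | inj₂ eq = let A , eq′ = go xs in A , trans eq eq′

minOver-glb : ∀ {n} {m} (g : Subset n → ℕ) → (∀ A → m ≤ g A) → m ≤ minOver g
minOver-glb g m≤g = let A , eq = minOver-attained g in subst (_ ≤_) (sym eq) (m≤g A)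

minOver-mono : ∀ {n} {g h : Subset n → ℕ} → (∀ A → g A ≤ h A) → minOver g ≤ minOver h
minOver-mono {g = g} {h} g≤h = minOver-glb h λ A → ≤-trans (minOver-≤ g A) (g≤h A)

minOver-cong : ∀ {n} {g h : Subset n → ℕ} → (∀ A → g A ≡ h A) → minOver g ≡ minOver h
minOver-cong g≡h = ≤-antisym (minOver-mono (≤-reflexive ∘ g≡h)) (minOver-mono (≤-reflexive ∘ sym ∘ g≡h))

minOver-+ : ∀ {n} k (g : Subset n → ℕ) → minOver (λ A → k + g A) ≡ k + minOver g
minOver-+ k g = ≤-antisym
  (let A , eq = minOver-attained g in
   ≤-trans (minOver-≤ (λ A → k + g A) A) (≤-reflexive (cong (k +_) (sym eq))))
  (minOver-glb _ λ A → +-monoʳ-≤ k (minOver-≤ g A))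

minOver-⊓ : ∀ {n} (g h : Subset n → ℕ) → minOver (λ A → g A ⊓ h A) ≡ minOver g ⊓ minOver h
minOver-⊓ g h = ≤-antisym
  (⊓-glb (minOver-mono λ A → m⊓n≤m (g A) (h A)) (minOver-mono λ A → m⊓n≤n (g A) (h A)))
  (minOver-glb _ λ A → ⊓-mono-≤ (minOver-≤ g A) (minOver-≤ h A))

minOver-insertAt : ∀ {n} (e : Fin (suc n)) (g : Subset (suc n) → ℕ) →
  minOver g ≡ minOver (λ B → g (insertAt B e false) ⊓ g (insertAt B e true))
minOver-insertAt e g = ≤-antisym
  (minOver-glb split λ B → ⊓-glb (minOver-≤ g _) (minOver-≤ g _))
  (minOver-glb g λ A → ≤-trans (minOver-≤ split (removeAt A e))
     (subst (λ A′ → split (removeAt A e) ≤ g A′) (insertAt-removeAt A e)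
            (split-≤ (removeAt A e) (lookup A e))))
  where
  split : Subset _ → ℕ
  split B = g (insertAt B e false) ⊓ g (insertAt B e true)
  split-≤ : ∀ B b → split B ≤ g (insertAt B e b)
  split-≤ B false = m⊓n≤m _ _
  split-≤ B true  = m⊓n≤n _ _

-- The rank formula  min_A ρ(A) + |W − Z_A|

covered : ∀ {n} → (Fin n → Subset 2) → Subset n → GSub n
covered z A = tabulate λ f → if lookup A f then z f else ⊥

-- natRank ρ is by definition coverRank ρ (λ f → below (ρ ⁅ f ⁆)).
coverRank : ∀ {n} → (Subset n → ℕ) → (Fin n → Subset 2) → GSub n → ℕ
coverRank ρ z W = minOver λ A → ρ A + ∣ W ─ᵍ covered z A ∣ᵍ

blockRank : ∀ {n} → (Subset n → ℕ) → GSub n → ℕ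
blockRank ρ = coverRank ρ (λ _ → ⊤)

coverRank-congˡ : ∀ {n} {g h : Subset n → ℕ} z W → (∀ A → g A ≡ h A) →
  coverRank g z W ≡ coverRank h z W
coverRank-congˡ z W g≡h = minOver-cong λ A → cong (_+ _) (g≡h A)

coverRank-congʳ : ∀ {n} (ρ : Subset n → ℕ) {z z′ : Fin n → Subset 2} W → (∀ f → z f ≡ z′ f) →
  coverRank ρ z W ≡ coverRank ρ z′ W
coverRank-congʳ ρ W z≡z′ = minOver-cong λ A →
  cong (λ C → ρ A + ∣ W ─ᵍ C ∣ᵍ) (tabulate-cong λ f → cong (if lookup A f then_else ⊥) (z≡z′ f))

coverRank-monoˡ : ∀ {n} {g h : Subset n → ℕ} z W → (∀ A → g A ≤ h A) → coverRank g z W ≤ coverRank h z W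
coverRank-monoˡ {g = g} {h} z W g≤h =
  minOver-mono {g = λ A → g A + ∣ W ─ᵍ covered z A ∣ᵍ} {h = λ A → h A + ∣ W ─ᵍ covered z A ∣ᵍ}
               (λ A → +-monoˡ-≤ _ (g≤h A))

coverRank-+ : ∀ {n} k (g : Subset n → ℕ) z W → coverRank (λ A → k + g A) z W ≡ k + coverRank g z W
coverRank-+ k g z W =
  trans (minOver-cong λ A → +-assoc k (g A) _) (minOver-+ k λ A → g A + ∣ W ─ᵍ covered z A ∣ᵍ)

coverRank-⊓ : ∀ {n} (g h : Subset n → ℕ) z W →
  coverRank (λ A → g A ⊓ h A) z W ≡ coverRank g z W ⊓ coverRank h z W
coverRank-⊓ g h z W = trans (minOver-cong λ A → +-distribʳ-⊓ _ (g A) (h A))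
  (minOver-⊓ (λ A → g A + ∣ W ─ᵍ covered z A ∣ᵍ) (λ A → h A + ∣ W ─ᵍ covered z A ∣ᵍ))

coverRank-empty : ∀ {n} (ρ : Subset n → ℕ) z → ρ ⊥ ≡ 0 → coverRank ρ z emptyᵍ ≡ 0
coverRank-empty ρ z ρ⊥≡0 = n≤0⇒n≡0 (≤-trans (minOver-≤ (λ A → ρ A + ∣ emptyᵍ ─ᵍ covered z A ∣ᵍ) ⊥)
                                              (≤-reflexive (cong₂ _+_ ρ⊥≡0 (∣emptyᵍ─ᵍ∣ (covered z ⊥)))))

lookup-─ᵍ-covered : ∀ {n} (W : GSub n) z A f →
  lookup (W ─ᵍ covered z A) f ≡ lookup W f ─ (if lookup A f then z f else ⊥)
lookup-─ᵍ-covered W z A f =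
  trans (lookup-zipWith _─_ f W (covered z A)) (cong (lookup W f ─_) (lookup∘tabulate _ f))

coverRank-⊤ : ∀ {n} (ρ : Subset n → ℕ) z W → (∀ f → lookup W f ⊆ z f) → coverRank ρ z W ≡ blockRank ρ W
coverRank-⊤ ρ z W W⊆z = minOver-cong λ A → cong (λ V → ρ A + ∣ V ∣ᵍ)
  (lookup-extensionality {xs = W ─ᵍ covered z A} {ys = W ─ᵍ covered (λ _ → ⊤) A} λ f →
  trans (lookup-─ᵍ-covered W z A f)
        (trans (─-if-⊆ (W⊆z f) (lookup A f)) (sym (lookup-─ᵍ-covered W (λ _ → ⊤) A f))))

covered-insertAt : ∀ {n} (z : Fin (suc n) → Subset 2) B (e : Fin (suc n)) b →
  covered z (insertAt B e b) ≡ insertAt (covered (z ∘ punchIn e) B) e (if b then z e else ⊥)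
covered-insertAt z B       zero    b = refl
covered-insertAt z (a ∷ B) (suc e) b = cong (_ ∷_) (covered-insertAt (z ∘ suc) B e b)

deletion adjoin : ∀ {n} → (Subset (suc n) → ℕ) → Fin (suc n) → Subset n → ℕ
deletion ρ e B = ρ (insertAt B e false)
adjoin   ρ e B = ρ (insertAt B e true)

coverRank-insertAt : ∀ {n} (ρ : Subset (suc n) → ℕ) z (e : Fin (suc n)) X s →
  coverRank ρ z (insertAt X e s) ≡
    (∣ s ∣ + coverRank (deletion ρ e) (z ∘ punchIn e) X)
      ⊓ (∣ s ─ z e ∣ + coverRank (adjoin ρ e) (z ∘ punchIn e) X)
coverRank-insertAt ρ z e X s = begin
  coverRank ρ z (insertAt X e s)
    ≡⟨ minOver-insertAt e _ ⟩
  minOver (λ B → value B false ⊓ value B true)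
    ≡⟨ minOver-cong (λ B → cong₂ _⊓_ (trans (value-insertAt B false)
                                             (cong (λ t → ∣ t ∣ + (deletion ρ e B + D B)) (p─⊥≡p s)))
                                      (value-insertAt B true)) ⟩
  minOver (λ B → deleted B ⊓ adjoined B)
    ≡⟨ minOver-⊓ deleted adjoined ⟩
  minOver deleted ⊓ minOver adjoined
    ≡⟨ cong₂ _⊓_ (minOver-+ ∣ s ∣ (λ B → deletion ρ e B + D B))
                 (minOver-+ ∣ s ─ z e ∣ (λ B → adjoin ρ e B + D B)) ⟩
  (∣ s ∣ + coverRank (deletion ρ e) (z ∘ punchIn e) X)
    ⊓ (∣ s ─ z e ∣ + coverRank (adjoin ρ e) (z ∘ punchIn e) X) ∎
  where
  open ≡-Reasoning
  D deleted adjoined : Subset _ → ℕ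
  D B = ∣ X ─ᵍ covered (z ∘ punchIn e) B ∣ᵍ
  deleted  B = ∣ s ∣ + (deletion ρ e B + D B)
  adjoined B = ∣ s ─ z e ∣ + (adjoin ρ e B + D B)
  value : Subset _ → Bool → ℕ
  value B b = ρ (insertAt B e b) + ∣ insertAt X e s ─ᵍ covered z (insertAt B e b) ∣ᵍ
  value-insertAt : ∀ B b → value B b ≡ ∣ s ─ (if b then z e else ⊥) ∣ + (ρ (insertAt B e b) + D B)
  value-insertAt B b
    rewrite covered-insertAt z B e b
          | zipWith-insertAt _─_ X (covered (z ∘ punchIn e) B) e s (if b then z e else ⊥)
          | ∣insertAt∣ᵍ (X ─ᵍ covered (z ∘ punchIn e) B) e (s ─ (if b then z e else ⊥))
          = trans (sym (+-assoc (ρ (insertAt B e b)) (D B) _)) (+-comm _ ∣ s ─ (if b then z e else ⊥) ∣)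

-- The 2-natural matroid

Subadditive : ∀ {n} → (Subset n → ℕ) → Set
Subadditive ρ = ∀ A B → ρ (A ∪ B) ≤ ρ A + ρ B

Submodular : ∀ {n} → (Subset n → ℕ) → Set
Submodular ρ = ∀ A B → ρ (A ∪ B) + ρ (A ∩ B) ≤ ρ A + ρ B

submodular⇒subadditive : ∀ {n} {ρ : Subset n → ℕ} → Submodular ρ → Subadditive ρ
submodular⇒subadditive submodular A B = ≤-trans (m≤m+n _ _) (submodular A B)

blockRank-insertAt : ∀ {n} (ρ : Subset (suc n) → ℕ) f W t →
  blockRank ρ (insertAt W f t) ≡ (∣ t ∣ + blockRank (deletion ρ f) W) ⊓ blockRank (adjoin ρ f) W
blockRank-insertAt ρ f W t = trans (coverRank-insertAt ρ (λ _ → ⊤) f W t)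
  (cong (λ k → (∣ t ∣ + blockRank (deletion ρ f) W) ⊓ (k + blockRank (adjoin ρ f) W))
        (trans (cong ∣_∣ (p─⊤≡⊥ t)) (∣⊥∣≡0 2)))

blockRank-adjoin-≤ : ∀ {n} (ρ : Subset (suc n) → ℕ) → Subadditive ρ → ∀ f W →
  blockRank (adjoin ρ f) W ≤ ρ ⁅ f ⁆ + blockRank (deletion ρ f) W
blockRank-adjoin-≤ ρ subadd f W =
  ≤-trans (coverRank-monoˡ (λ _ → ⊤) W adjoin-≤) (≤-reflexive (coverRank-+ (ρ ⁅ f ⁆) (deletion ρ f) _ W))
  where
  adjoin-≤ : ∀ B → adjoin ρ f B ≤ ρ ⁅ f ⁆ + deletion ρ f B
  adjoin-≤ B = subst (λ A → ρ A ≤ ρ ⁅ f ⁆ + deletion ρ f B) (insertAt-∪-⁅⁆ B f)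
                     (≤-trans (subadd _ _) (≤-reflexive (+-comm _ (ρ ⁅ f ⁆))))

⊓-principalExt : ∀ {a b r k m} → b ≤ r + a → r ≤ m →
  (suc k + a) ⊓ b ≡ (if (m + a) ⊓ b ≡ᵇ (k + a) ⊓ b then (k + a) ⊓ b else suc ((k + a) ⊓ b))
⊓-principalExt {a} {b} {r} {k} {m} b≤r+a r≤m rewrite m≥n⇒m⊓n≡n (≤-trans b≤r+a (+-monoˡ-≤ a r≤m))
  with b ≤? k + a
... | yes b≤k+a rewrite m≥n⇒m⊓n≡n b≤k+a | dec-true (b ≟ℕ b) refl = m≥n⇒m⊓n≡n (m≤n⇒m≤1+n b≤k+a)
... | no  b≰k+a rewrite m≤n⇒m⊓n≡m (<⇒≤ (≰⇒> b≰k+a)) | dec-false (b ≟ℕ k + a) (b≰k+a ∘ ≤-reflexive) =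
  m≤n⇒m⊓n≡m (≰⇒> b≰k+a)

-- principalExt r f i F S unfolds to principalRule (p ∈ S) (r ((S − p) ∪ F)) (r (S − p)) (r S), p = (f , i).
principalRule : Bool → ℕ → ℕ → ℕ → ℕ
principalRule p∈S u v w = if p∈S then (if u ≡ᵇ v then v else suc v) else w

principalRule-cong : ∀ {b b′ u u′ v v′ w w′} → b ≡ b′ → u ≡ u′ → v ≡ v′ → w ≡ w′ →
  principalRule b u v w ≡ principalRule b′ u′ v′ w′
principalRule-cong refl refl refl refl = refl

principalRule-slot : ∀ {a b k} (s g : Subset 2) i → k ≤ 2 → below k ⊆ g → b ≤ k + a →
  principalRule (lookup s i) ((∣ ((s ─ ⁅ i ⁆) ∪ below k) ∩ g ∣ + a) ⊓ b)
                             ((∣ (s ─ ⁅ i ⁆) ∩ g ∣ + a) ⊓ b) ((∣ s ∩ g ∣ + a) ⊓ b)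
    ≡ (∣ s ∩ (g ∪ ⁅ i ⁆) ∣ + a) ⊓ b
principalRule-slot {a} {b} {k} s g i k≤2 below⊆g b≤k+a with lookup s i in s∋i
... | false = cong (λ t → (∣ t ∣ + a) ⊓ b) (sym (∩-∪-⁅⁆-∉ s g i s∋i))
... | true  = sym (trans (cong (λ l → (l + a) ⊓ b) (∣∩-∪-⁅⁆∣-∈ s g i s∋i))
                         (⊓-principalExt b≤k+a (≤-trans (k≤∣below∣ k k≤2) (p⊆q⇒∣p∣≤∣q∣ below⊆))))
  where
  below⊆ : below k ⊆ ((s ─ ⁅ i ⁆) ∪ below k) ∩ g
  below⊆ j∈ = x∈p∩q⁺ (q⊆p∪q _ _ j∈ , below⊆g j∈)

principalExt-blockRank : ∀ {n} (ρ : Subset (suc n) → ℕ) → Subadditive ρ → ∀ f → ρ ⁅ f ⁆ ≤ 2 →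
  ∀ i G₀ g → below (ρ ⁅ f ⁆) ⊆ g → ∀ (r : GSub (suc n) → ℕ) →
  (∀ S → r S ≡ blockRank ρ (S ∩ᵍ insertAt G₀ f g)) → ∀ S₀ s →
  principalExt r f i (Xof ρ f) (insertAt S₀ f s)
    ≡ blockRank ρ (insertAt S₀ f s ∩ᵍ (insertAt G₀ f g ∪ᵍ elemᵍ f i))
principalExt-blockRank ρ subadd f ρf≤2 i G₀ g x⊆g r r≗ S₀ s = begin
  principalExt r f i (Xof ρ f) S
    ≡⟨ principalRule-cong (cong (λ t → lookup t i) (insertAt-lookup S₀ f s)) (trans (r≗ _) (cong R join))
                          (trans (r≗ _) (cong R delete)) (trans (r≗ _) (cong R keep)) ⟩
  principalRule (lookup s i) (T (((s ─ ⁅ i ⁆) ∪ x) ∩ g)) (T ((s ─ ⁅ i ⁆) ∩ g)) (T (s ∩ g))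
    ≡⟨ principalRule-cong {b = lookup s i} refl (closed (((s ─ ⁅ i ⁆) ∪ x) ∩ g))
                          (closed ((s ─ ⁅ i ⁆) ∩ g)) (closed (s ∩ g)) ⟩
  principalRule (lookup s i) ((∣ ((s ─ ⁅ i ⁆) ∪ x) ∩ g ∣ + a) ⊓ b)
                             ((∣ (s ─ ⁅ i ⁆) ∩ g ∣ + a) ⊓ b) ((∣ s ∩ g ∣ + a) ⊓ b)
    ≡⟨ principalRule-slot s g i ρf≤2 x⊆g (blockRank-adjoin-≤ ρ subadd f W) ⟩
  (∣ s ∩ (g ∪ ⁅ i ⁆) ∣ + a) ⊓ b
    ≡⟨ closed _ ⟨
  T (s ∩ (g ∪ ⁅ i ⁆))
    ≡⟨ cong R add ⟨
  R (S ∩ᵍ (insertAt G₀ f g ∪ᵍ elemᵍ f i)) ∎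
  where
  open ≡-Reasoning
  R = blockRank ρ
  S = insertAt S₀ f s
  W = S₀ ∩ᵍ G₀
  x = below (ρ ⁅ f ⁆)
  a = blockRank (deletion ρ f) W
  b = blockRank (adjoin ρ f) W
  T : Subset 2 → ℕ
  T t = R (insertAt W f t)
  closed : ∀ t → T t ≡ (∣ t ∣ + a) ⊓ b
  closed = blockRank-insertAt ρ f W
  S─p : S ─ᵍ elemᵍ f i ≡ insertAt S₀ f (s ─ ⁅ i ⁆)
  S─p = trans (cong (S ─ᵍ_) (elemᵍ-insertAt f i)) (─ᵍ-slot S₀ f s ⁅ i ⁆)
  keep : S ∩ᵍ insertAt G₀ f g ≡ insertAt W f (s ∩ g)
  keep = zipWith-insertAt _∩_ S₀ G₀ f s g
  delete : (S ─ᵍ elemᵍ f i) ∩ᵍ insertAt G₀ f g ≡ insertAt W f ((s ─ ⁅ i ⁆) ∩ g)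
  delete = trans (cong (_∩ᵍ insertAt G₀ f g) S─p) (zipWith-insertAt _∩_ S₀ G₀ f _ g)
  join : ((S ─ᵍ elemᵍ f i) ∪ᵍ Xof ρ f) ∩ᵍ insertAt G₀ f g ≡ insertAt W f (((s ─ ⁅ i ⁆) ∪ x) ∩ g)
  join = trans (cong (_∩ᵍ insertAt G₀ f g)
                     (trans (cong₂ _∪ᵍ_ S─p (Xof-insertAt ρ f)) (∪ᵍ-slot S₀ f (s ─ ⁅ i ⁆) x)))
               (zipWith-insertAt _∩_ S₀ G₀ f _ g)
  add : S ∩ᵍ (insertAt G₀ f g ∪ᵍ elemᵍ f i) ≡ insertAt W f (s ∩ (g ∪ ⁅ i ⁆))
  add = trans (cong (S ∩ᵍ_) (trans (cong (insertAt G₀ f g ∪ᵍ_) (elemᵍ-insertAt f i))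
                                   (∪ᵍ-slot G₀ f g ⁅ i ⁆)))
              (zipWith-insertAt _∩_ S₀ G₀ f s _)

freeExtension-step : ∀ {n} (ρ : Subset n → ℕ) → Subadditive ρ → (∀ f → ρ ⁅ f ⁆ ≤ 2) →
  ∀ (r : GSub n → ℕ) G f i → below (ρ ⁅ f ⁆) ⊆ lookup G f → (∀ S → r S ≡ blockRank ρ (S ∩ᵍ G)) →
  ∀ S → principalExt r f i (Xof ρ f) S ≡ blockRank ρ (S ∩ᵍ (G ∪ᵍ elemᵍ f i))
freeExtension-step {suc n} ρ subadd ρ≤2 r G f i x⊆G r≗ S =
  subst₂ (λ G′ S′ → principalExt r f i (Xof ρ f) S′ ≡ blockRank ρ (S′ ∩ᵍ (G′ ∪ᵍ elemᵍ f i)))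
         (insertAt-removeAt G f) (insertAt-removeAt S f)
         (principalExt-blockRank ρ subadd f (ρ≤2 f) i (removeAt G f) (lookup G f) x⊆G r r≗′
                                 (removeAt S f) (lookup S f))
  where
  r≗′ : ∀ S → r S ≡ blockRank ρ (S ∩ᵍ insertAt (removeAt G f) f (lookup G f))
  r≗′ S = trans (r≗ S) (cong (λ G′ → blockRank ρ (S ∩ᵍ G′)) (sym (insertAt-removeAt G f)))

module FreeExtension {n} (ρ : Subset n → ℕ) (subadd : Subadditive ρ) (ρ≤2 : ∀ f → ρ ⁅ f ⁆ ≤ 2) where

  -- rank2 ρ is by definition foldl extend (λ S → natRank ρ (S ∩ᵍ XE ρ)) (newElems ρ).
  extend : (GSub n → ℕ) → Fin n × Fin 2 → GSub n → ℕ
  extend r p = principalExt r (proj₁ p) (proj₂ p) (Xof ρ (proj₁ p))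

  addElem : GSub n → Fin n × Fin 2 → GSub n
  addElem G p = G ∪ᵍ elemᵍ (proj₁ p) (proj₂ p)

  RanksOn : GSub n → (GSub n → ℕ) → Set
  RanksOn G r = ∀ S → r S ≡ blockRank ρ (S ∩ᵍ G)

  natRank-RanksOn : RanksOn (XE ρ) (λ S → natRank ρ (S ∩ᵍ XE ρ))
  natRank-RanksOn S = coverRank-⊤ ρ _ (S ∩ᵍ XE ρ) λ f →
    subst₂ _⊆_ (sym (lookup-zipWith _∩_ f S (XE ρ))) (lookup∘tabulate _ f) (p∩q⊆q _ _)

  foldl-RanksOn : ∀ L G r → XE ρ ⊆ᵍ G → RanksOn G r → RanksOn (foldl addElem G L) (foldl extend r L)
  foldl-RanksOn []            G r _     r≗ = r≗
  foldl-RanksOn ((f , i) ∷ L) G r XE⊆G r≗ =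
    foldl-RanksOn L _ _ (λ g x∈ → ⊆ᵍ-∪ᵍ G _ g (XE⊆G g x∈))
      (freeExtension-step ρ subadd ρ≤2 r G f i (subst (_⊆ lookup G f) (lookup∘tabulate _ f) (XE⊆G f)) r≗)

  foldl-⊇ : ∀ L G → G ⊆ᵍ foldl addElem G L
  foldl-⊇ []      G f x∈ = x∈
  foldl-⊇ (p ∷ L) G f x∈ = foldl-⊇ L (addElem G p) f (⊆ᵍ-∪ᵍ G _ f x∈)

  foldl-∋ : ∀ L G {f j} → (f , j) ∈ˡ L → j ∈ lookup (foldl addElem G L) f
  foldl-∋ (_ ∷ L) G {f} {j} (Any.here refl) = foldl-⊇ L _ f
    (subst (j ∈_) (sym (lookup-zipWith _∪_ f G (elemᵍ f j)))
           (q⊆p∪q _ _ (subst (j ∈_) (sym (lookup-elemᵍ f j)) (x∈⁅x⁆ j))))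
  foldl-∋ (p ∷ L) G (Any.there j∈L) = foldl-∋ L (addElem G p) j∈L

  groundSet : GSub n
  groundSet = foldl addElem (XE ρ) (newElems ρ)

  groundSet-full : ∀ f j → j ∈ lookup groundSet f
  groundSet-full f j with toℕ j <? ρ ⁅ f ⁆
  ... | yes j<ρf = foldl-⊇ (newElems ρ) (XE ρ) f (subst (j ∈_) (sym (lookup∘tabulate _ f)) (∈-below j<ρf))
  ... | no  j≮ρf = foldl-∋ (newElems ρ) (XE ρ)
    (∈-filter⁺ (λ p → ρ ⁅ proj₁ p ⁆ ≤? toℕ (proj₂ p)) (allPairs-complete f j) (≮⇒≥ j≮ρf))

  rank2≡blockRank : ∀ S → rank2 ρ S ≡ blockRank ρ S
  rank2≡blockRank S = trans (foldl-RanksOn (newElems ρ) (XE ρ) _ (λ _ x∈ → x∈) natRank-RanksOn S)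
                            (cong (blockRank ρ) (∩ᵍ-full S groundSet groundSet-full))

-- Compression

Nondecreasing : ∀ {n} → (Subset n → ℕ) → Set
Nondecreasing ρ = ∀ A B → A ⊆ B → ρ A ≤ ρ B

⊓-compress : ∀ {x y} → x ≤ y → 0 < y → suc x ⊓ y ≡ suc (if y ≡ᵇ x then x ∸ 1 else x)
⊓-compress {x} {y} x≤y 0<y with y ≟ℕ x
... | yes refl rewrite dec-true (y ≟ℕ y) refl = trans (m≥n⇒m⊓n≡n (n≤1+n y)) (sym (m+[n∸m]≡n 0<y))
... | no y≢x   rewrite dec-false (y ≟ℕ x) y≢x = m≤n⇒m⊓n≡m (≤∧≢⇒< x≤y (y≢x ∘ sym))

⊓-+-⊓-glb : ∀ {t a b c d} → t ≤ a + c → t ≤ a + d → t ≤ b + c → t ≤ b + d → t ≤ (a ⊓ b) + (c ⊓ d)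
⊓-+-⊓-glb {t} {a} {b} {c} {d} ac ad bc bd = subst (t ≤_) (sym distrib)
  (⊓-glb (⊓-glb ac ad) (⊓-glb bc bd))
  where
  distrib : (a ⊓ b) + (c ⊓ d) ≡ ((a + c) ⊓ (a + d)) ⊓ ((b + c) ⊓ (b + d))
  distrib = trans (+-distribʳ-⊓ (c ⊓ d) a b) (cong₂ _⊓_ (+-distribˡ-⊓ a c d) (+-distribˡ-⊓ b c d))

module Compression {n} (ρ : Subset (suc n) → ℕ) (e : Fin (suc n))
                   (mono : Nondecreasing ρ) (e-nonloop : 0 < ρ ⁅ e ⁆) where

  c : Subset n → ℕ
  c = compress ρ e

  compress-≡ : ∀ B → c B ≡ (if adjoin ρ e B ≡ᵇ deletion ρ e B then deletion ρ e B ∸ 1 else deletion ρ e B)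
  compress-≡ B = cong (λ A → if ρ A ≡ᵇ deletion ρ e B then deletion ρ e B ∸ 1 else deletion ρ e B)
                      (insertAt-∪-⁅⁆ B e)

  deletion≤adjoin : ∀ B → deletion ρ e B ≤ adjoin ρ e B
  deletion≤adjoin B = mono _ _ (subst (insertAt B e false ⊆_) (insertAt-∪-⁅⁆ B e) (p⊆p∪q _))

  adjoin-positive : ∀ B → 0 < adjoin ρ e B
  adjoin-positive B = <-≤-trans e-nonloop (mono _ _ (subst (⁅ e ⁆ ⊆_) (insertAt-∪-⁅⁆ B e) (q⊆p∪q _ _)))

  compress-min : ∀ B → suc (deletion ρ e B) ⊓ adjoin ρ e B ≡ suc (c B)
  compress-min B =
    trans (⊓-compress (deletion≤adjoin B) (adjoin-positive B)) (cong suc (sym (compress-≡ B)))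

  compress-≤-deletion : ∀ B → c B ≤ deletion ρ e B
  compress-≤-deletion B = ≤-pred (subst (_≤ suc (deletion ρ e B)) (compress-min B) (m⊓n≤m _ _))

  compress-≤-adjoin : ∀ B → suc (c B) ≤ adjoin ρ e B
  compress-≤-adjoin B = subst (_≤ adjoin ρ e B) (compress-min B) (m⊓n≤n _ _)

  compress-normalized : ρ ⊥ ≡ 0 → c ⊥ ≡ 0
  compress-normalized ρ⊥≡0 =
    n≤0⇒n≡0 (≤-trans (compress-≤-deletion ⊥) (≤-reflexive (trans (cong ρ (insertAt-⊥ e)) ρ⊥≡0)))

  compress-subadditive : Submodular ρ → Subadditive c
  compress-subadditive submodular A B =
    ≤-pred (≤-pred (subst (t ≤_) compress-sum
      (⊓-+-⊓-glb {a = suc (d A)} {j A} {suc (d B)} {j B} dd dj jd jj)))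
    where
    t : ℕ
    t = suc (suc (c (A ∪ B)))
    d j : Subset n → ℕ
    d = deletion ρ e
    j = adjoin ρ e
    compress-sum : (suc (d A) ⊓ j A) + (suc (d B) ⊓ j B) ≡ suc (suc (c A + c B))
    compress-sum = trans (cong₂ _+_ (compress-min A) (compress-min B)) (cong suc (+-suc (c A) (c B)))
    union : ∀ a b → ρ (insertAt (A ∪ B) e (a ∨ b)) ≤ ρ (insertAt A e a) + ρ (insertAt B e b)
    union a b = subst (λ X → ρ X ≤ ρ (insertAt A e a) + ρ (insertAt B e b))
                      (zipWith-insertAt _∨_ A B e a b)
                      (submodular⇒subadditive {ρ = ρ} submodular _ _)
    j-submodular : j (A ∪ B) + j (A ∩ B) ≤ j A + j B
    j-submodular = subst₂ (λ X Y → ρ X + ρ Y ≤ j A + j B)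
      (zipWith-insertAt _∨_ A B e true true) (zipWith-insertAt _∧_ A B e true true) (submodular _ _)
    c∪<j : suc (c (A ∪ B)) ≤ j (A ∪ B)
    c∪<j = compress-≤-adjoin (A ∪ B)
    dd : t ≤ suc (d A) + suc (d B)
    dd = subst (t ≤_) (sym (cong suc (+-suc (d A) (d B))))
               (s≤s (s≤s (≤-trans (compress-≤-deletion (A ∪ B)) (union false false))))
    dj : t ≤ suc (d A) + j B
    dj = s≤s (≤-trans c∪<j (union false true))
    jd : t ≤ j A + suc (d B)
    jd = subst (t ≤_) (sym (+-suc (j A) (d B))) (s≤s (≤-trans c∪<j (union true false)))
    jj : t ≤ j A + j B
    jj = ≤-trans (s≤s c∪<j) (≤-trans (subst (_≤ j (A ∪ B) + j (A ∩ B)) (+-comm (j (A ∪ B)) 1)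
                                             (+-monoʳ-≤ (j (A ∪ B)) (adjoin-positive (A ∩ B))))
                                      j-submodular)

  coverRank-contract : ∀ z {i} → i ∈ z e → ∀ X →
    coverRank ρ z (insertAt X e ⁅ i ⁆) ≡ suc (coverRank c (z ∘ punchIn e) X)
  coverRank-contract z {i} i∈ze X = begin
    coverRank ρ z (insertAt X e ⁅ i ⁆)
      ≡⟨ coverRank-insertAt ρ z e X ⁅ i ⁆ ⟩
    (∣ ⁅ i ⁆ ∣ + coverRank d z′ X) ⊓ (∣ ⁅ i ⁆ ─ z e ∣ + coverRank j z′ X)
      ≡⟨ cong₂ (λ k l → (k + coverRank d z′ X) ⊓ (l + coverRank j z′ X))
               (∣⁅x⁆∣≡1 i) (trans (cong ∣_∣ (─-⊆ ⁅i⁆⊆ze)) (∣⊥∣≡0 2)) ⟩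
    suc (coverRank d z′ X) ⊓ coverRank j z′ X
      ≡⟨ cong (_⊓ coverRank j z′ X) (coverRank-+ 1 d z′ X) ⟨
    coverRank (λ B → suc (d B)) z′ X ⊓ coverRank j z′ X
      ≡⟨ coverRank-⊓ (λ B → suc (d B)) j z′ X ⟨
    coverRank (λ B → suc (d B) ⊓ j B) z′ X
      ≡⟨ coverRank-congˡ z′ X compress-min ⟩
    coverRank (λ B → suc (c B)) z′ X
      ≡⟨ coverRank-+ 1 c z′ X ⟩
    suc (coverRank c z′ X) ∎
    where
    open ≡-Reasoning
    d j : Subset n → ℕ
    d = deletion ρ e
    j = adjoin ρ e
    z′ : Fin n → Subset 2
    z′ = z ∘ punchIn e
    ⁅i⁆⊆ze : ⁅ i ⁆ ⊆ z e
    ⁅i⁆⊆ze k∈⁅i⁆ = subst (_∈ z e) (sym (x∈⁅y⁆⇒x≡y i k∈⁅i⁆)) i∈ze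

  contractDelete-coverRank : ρ ⊥ ≡ 0 → ∀ z {i} → i ∈ z e → ∀ X →
    contractDelete (coverRank ρ z) e i X ≡ coverRank c (z ∘ punchIn e) X
  contractDelete-coverRank ρ⊥≡0 z {i} i∈ze X = cong₂ _∸_ (coverRank-contract z i∈ze X) (begin
    coverRank ρ z (elemᵍ e i)                ≡⟨ cong (coverRank ρ z) (elemᵍ-insertAt e i) ⟩
    coverRank ρ z (insertAt emptyᵍ e ⁅ i ⁆)  ≡⟨ coverRank-contract z i∈ze emptyᵍ ⟩
    suc (coverRank c (z ∘ punchIn e) emptyᵍ) ≡⟨ cong suc (coverRank-empty c _ (compress-normalized ρ⊥≡0)) ⟩
    1                                        ∎)
    where open ≡-Reasoning

  compress-⁅⁆ : IsLine ρ e → (∀ f → ρ ⁅ f ⁆ ≤ 2) → NoLineParallelTo ρ e →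
    ∀ f → c ⁅ f ⁆ ≡ ρ ⁅ punchIn e f ⁆
  compress-⁅⁆ line ρ≤2 noParallel f with adjoin ρ e ⁅ f ⁆ ≟ℕ deletion ρ e ⁅ f ⁆
  ... | no adjoin≢deletion rewrite compress-≡ ⁅ f ⁆ | dec-false (_ ≟ℕ _) adjoin≢deletion =
    cong ρ (insertAt-⁅⁆ e f)
  ... | yes adjoin≡deletion = contradiction parallel (noParallel f′ (punchInᵢ≢i e f) f′-line)
    where
    f′ = punchIn e f
    ef′≡f′ : ρ (⁅ e ⁆ ∪ ⁅ f′ ⁆) ≡ ρ ⁅ f′ ⁆
    ef′≡f′ = trans (cong ρ (sym (insertAt-⁅⁆-true e f))) (trans adjoin≡deletion (cong ρ (insertAt-⁅⁆ e f)))
    f′-line : IsLine ρ f′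
    f′-line = ≤-antisym (ρ≤2 f′)
      (subst (_≤ ρ ⁅ f′ ⁆) line (≤-trans (mono _ _ (p⊆p∪q _)) (≤-reflexive ef′≡f′)))
    parallel : Parallel ρ e f′
    parallel = e-nonloop , trans line (sym f′-line) , sym ef′≡f′

  compress-≤2 : (∀ f → ρ ⁅ f ⁆ ≤ 2) → ∀ f → c ⁅ f ⁆ ≤ 2
  compress-≤2 ρ≤2 f = ≤-trans (compress-≤-deletion ⁅ f ⁆)
    (subst (λ A → ρ A ≤ 2) (sym (insertAt-⁅⁆ e f)) (ρ≤2 (punchIn e f)))

  XE-compress : (∀ f → c ⁅ f ⁆ ≡ ρ ⁅ punchIn e f ⁆) → XE c ≡ groundMinor ρ e
  XE-compress c-⁅⁆ = sym (trans (removeAt-tabulate (λ f → below (ρ ⁅ f ⁆)) e)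
                                (tabulate-cong λ f → cong below (sym (c-⁅⁆ f))))

  rank2-compress : ρ ⊥ ≡ 0 → Submodular ρ → (∀ f → ρ ⁅ f ⁆ ≤ 2) →
    ∀ i X → rank2 c X ≡ contractDelete (rank2 ρ) e i X
  rank2-compress ρ⊥≡0 submodular ρ≤2 i X = begin
    rank2 c X                          ≡⟨ FreeExtension.rank2≡blockRank c (compress-subadditive submodular)
                                                                          (compress-≤2 ρ≤2) X ⟩
    blockRank c X                      ≡⟨ contractDelete-coverRank ρ⊥≡0 (λ _ → ⊤) ∈⊤ X ⟨
    contractDelete (blockRank ρ) e i X ≡⟨ cong₂ _∸_ (rank2≡blockRank _) (rank2≡blockRank _) ⟨
    contractDelete (rank2 ρ) e i X     ∎
    where
    open ≡-Reasoning
    open FreeExtension ρ (submodular⇒subadditive {ρ = ρ} submodular) ρ≤2 using (rank2≡blockRank)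

  natRank-compress : ρ ⊥ ≡ 0 → (∀ f → c ⁅ f ⁆ ≡ ρ ⁅ punchIn e f ⁆) → ∀ {i} → toℕ i < ρ ⁅ e ⁆ → ∀ X →
    natRank c X ≡ contractDelete (natRank ρ) e i X
  natRank-compress ρ⊥≡0 c-⁅⁆ {i} i<ρe X = begin
    natRank c X
      ≡⟨ coverRank-congʳ c X (λ f → cong below (c-⁅⁆ f)) ⟩
    coverRank c ((λ f → below (ρ ⁅ f ⁆)) ∘ punchIn e) X
      ≡⟨ contractDelete-coverRank ρ⊥≡0 (λ f → below (ρ ⁅ f ⁆)) (∈-below i<ρe) X ⟨
    contractDelete (natRank ρ) e i X ∎
    where open ≡-Reasoning

corollary5p2 : ∀ {n} (ρ : Subset (suc n) → ℕ) (e : Fin (suc n)) →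
    Is2Polymatroid ρ → IsLine ρ e →
    (∀ (i : Fin 2) (X : GSub n) →
       rank2 (compress ρ e) X ≡ contractDelete (rank2 ρ) e i X)
    × (NoLineParallelTo ρ e → ∀ (i : Fin 2) →
         (XE (compress ρ e) ≡ groundMinor ρ e)
         × (∀ (X : GSub n) → X ⊆ᵍ XE (compress ρ e) →
              natRank (compress ρ e) X ≡ contractDelete (natRank ρ) e i X))
corollary5p2 ρ e P line =
    rank2-compress normalized submodular atMost2
  , λ noParallel i → let c-⁅⁆ = compress-⁅⁆ line atMost2 noParallel in
      XE-compress c-⁅⁆
      -- natRank is its rank formula on every X.
    , λ X _ → natRank-compress normalized c-⁅⁆ (subst (toℕ i <_) (sym line) (toℕ<n i)) X
  where
  open Is2Polymatroid P using (isPolymatroid; atMost2)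
  open IsPolymatroid isPolymatroid using (normalized; nondecreasing; submodular)
  open Compression ρ e nondecreasing (subst (0 <_) (sym line) (s≤s z≤n))
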